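{- Let $k$ be a positive integer. Then, as formal power series in $q$ (equivalently, for complex $|q|<1$), $$\sum_{j=0}^\infty (-1)^j q^{j^2+2j(k+1)} = (q^{2k+3};q^2)_\infty \sum_{j=0}^\infty \frac{q^{j(2j+2k+3)}}{(q^2;q^2)_j(q^{2k+3};q^2)_j}.$$
   Context: The $q$-Pochhammer symbol is $(a;q)_0=1$, $(a;q)_n=(1-a)(1-aq)\cdots(1-aq^{n-1})$ for $n>0$, and $(a;q)_\infty=\lim_{n\to\infty}(a;q)_n$. -}

module Defs where

open import Data.Nat as ℕ using (ℕ; zero; suc; _∸_; _≟_)
open import Data.Integer as ℤ using (ℤ; 0ℤ; 1ℤ; -1ℤ; -_)
open import Data.List using (List; []; _∷_; length; upTo; map; zipWith; foldr)
open import Data.Bool using (if_then_else_)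
open import Relation.Nullary.Decidable using (⌊_⌋)

-- Formal power series in q with integer coefficients: n ↦ coefficient of q^n.
FPS : Set
FPS = ℕ → ℤ

Σ< : ℕ → (ℕ → ℤ) → ℤ
Σ< zero    f = 0ℤ
Σ< (suc n) f = Σ< n f ℤ.+ f n

qpow : ℕ → FPS
qpow e n = if ⌊ e ≟ n ⌋ then 1ℤ else 0ℤ

one : FPS
one = qpow 0

_⊕_ : FPS → FPS → FPS
(f ⊕ g) n = f n ℤ.+ g n

_⊖_ : FPS → FPS → FPS
(f ⊖ g) n = f n ℤ.- g n

_·_ : ℤ → FPS → FPS
(c · f) n = c ℤ.* f n

_⊗_ : FPS → FPS → FPS
(f ⊗ g) n = Σ< (suc n) (λ i → f i ℤ.* g (n ∸ i))

infixl 7 _⊗_ _·_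
infixl 6 _⊕_ _⊖_
infix 4 _≈_

-- Multiplicative inverse of a series with constant term 1:
-- b₀ = 1, b_m = - Σ_{i=1}^{m} a_i b_{m-i}.
-- invRev f m = [b_m, b_{m-1}, …, b_0].
invRev : FPS → ℕ → List ℤ
invRev f zero    = 1ℤ ∷ []
invRev f (suc m) = (- foldr ℤ._+_ 0ℤ (zipWith ℤ._*_ (map (λ i → f (suc i)) (upTo (length r))) r)) ∷ r
  where r = invRev f m

inv : FPS → FPS
inv f n with invRev f n
... | []    = 0ℤ
... | b ∷ _ = b

poch : ℕ → ℕ → ℕ → FPS
poch a d zero    = one
poch a d (suc j) = poch a d j ⊗ (one ⊖ qpow (a ℕ.+ d ℕ.* j))

-- (q^a ; q^d)_∞ for a ≥ 1, d ≥ 1: factors with index i ≥ n+1 have exponent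
-- a + d i > n, so the coefficient of q^n is that of the first n+1 factors.
pochInf : ℕ → ℕ → FPS
pochInf a d n = poch a d (suc n) n

-- Σ_{j ≥ 0} T j for a family with T j = O(q^j): the coefficient of q^n
-- only receives contributions from j ≤ n.
sumInf : (ℕ → FPS) → FPS
sumInf T n = Σ< (suc n) (λ j → T j n)

_≈_ : FPS → FPS → Set
f ≈ g = ∀ n → f n Relation.Binary.PropositionalEquality.≡ g n
  where import Relation.Binary.PropositionalEquality

-- Write T a j = q^(j(2j+a)) / ((q²;q²)_j (q^a;q²)_j), S a = Σ_j T a j and
-- R a = (q^a;q²)_∞ S a, so that the right-hand side is R (2k+3).  Comparing
-- T a (j+1) with T (a+2) (j+1) termwise gives
--   (1 - q^a)(1 - q^(a+2)) (S a - S (a+2)) = q^(a+2) S (a+4),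
-- hence R a = (1 - q^a) R (a+2) + q^(a+2) R (a+4).  So R a + q^a R (a+2) does
-- not change under a ↦ a+2; being ≡ 1 modulo q^a, it is 1, that is
-- R a = 1 - q^a R (a+2).  Splitting off the term j = 0 of the left-hand side
-- L b = Σ_j (-1)^j q^(j² + jb) gives L b = 1 - q^(b+1) L (b+2), and this
-- functional equation has a unique solution, so L b = R (b+1); take b = 2k+2.
module Submission where

open import Defs
open import Data.Nat as ℕ using (ℕ; zero; suc; _+_; _*_; _∸_; _≤_; _<_; _≟_; z≤n; s≤s)
import Data.Nat.Properties as ℕ
import Data.Nat.Tactic.RingSolver as ℕ-Solver
open import Data.Integer as ℤ using (ℤ; 0ℤ; 1ℤ; -1ℤ; -_; _-_; _^_)
import Data.Integer.Properties as ℤ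
import Data.Integer.Tactic.RingSolver as ℤ-Solver
open import Data.List using (length; upTo; map; zipWith; foldr; applyUpTo)
open import Data.List.Properties using (map-upTo)
open import Data.Maybe using (Maybe; just; nothing)
open import Data.Product using (_,_)
open import Data.Sum using (inj₁; inj₂)
open import Function using (_∘_)
open import Relation.Nullary using (Dec; yes; no; contradiction)
open import Relation.Binary.PropositionalEquality
  using (_≡_; _≢_; refl; sym; trans; cong; cong₂; subst; module ≡-Reasoning)
import Relation.Binary.Reasoning.Setoid as SetoidReasoning
open import Algebra.Bundles using (CommutativeRing)
import Algebra.Solver.Ring
import Algebra.Solver.Ring.AlmostCommutativeRing as ACR

-- Finite sums

Σ<-cong-< : ∀ n {f g : ℕ → ℤ} → (∀ i → i < n → f i ≡ g i) → Σ< n f ≡ Σ< n g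
Σ<-cong-< zero    f≡g = refl
Σ<-cong-< (suc n) f≡g =
  cong₂ ℤ._+_ (Σ<-cong-< n (λ i i<n → f≡g i (ℕ.m<n⇒m<1+n i<n))) (f≡g n (ℕ.n<1+n n))

Σ<-cong : ∀ n {f g : ℕ → ℤ} → (∀ i → f i ≡ g i) → Σ< n f ≡ Σ< n g
Σ<-cong n f≡g = Σ<-cong-< n (λ i _ → f≡g i)

Σ<-zero : ∀ n {f : ℕ → ℤ} → (∀ i → i < n → f i ≡ 0ℤ) → Σ< n f ≡ 0ℤ
Σ<-zero zero    f≡0 = refl
Σ<-zero (suc n) f≡0 =
  cong₂ ℤ._+_ (Σ<-zero n (λ i i<n → f≡0 i (ℕ.m<n⇒m<1+n i<n))) (f≡0 n (ℕ.n<1+n n))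

Σ<-+ : ∀ n (f g : ℕ → ℤ) → Σ< n (λ i → f i ℤ.+ g i) ≡ Σ< n f ℤ.+ Σ< n g
Σ<-+ zero    f g = refl
Σ<-+ (suc n) f g =
  trans (cong (ℤ._+ (f n ℤ.+ g n)) (Σ<-+ n f g)) (interchange (Σ< n f) (Σ< n g) (f n) (g n))
  where
  interchange : ∀ a b c d → (a ℤ.+ b) ℤ.+ (c ℤ.+ d) ≡ (a ℤ.+ c) ℤ.+ (b ℤ.+ d)
  interchange = ℤ-Solver.solve-∀

Σ<-neg : ∀ n (f : ℕ → ℤ) → Σ< n (λ i → - f i) ≡ - Σ< n f
Σ<-neg zero    f = refl
Σ<-neg (suc n) f =
  trans (cong (ℤ._+ (- f n)) (Σ<-neg n f)) (sym (ℤ.neg-distrib-+ (Σ< n f) (f n)))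

Σ<-*ˡ : ∀ n c (f : ℕ → ℤ) → Σ< n (λ i → c ℤ.* f i) ≡ c ℤ.* Σ< n f
Σ<-*ˡ zero    c f = sym (ℤ.*-zeroʳ c)
Σ<-*ˡ (suc n) c f =
  trans (cong (ℤ._+ (c ℤ.* f n)) (Σ<-*ˡ n c f)) (sym (ℤ.*-distribˡ-+ c (Σ< n f) (f n)))

Σ<-*ʳ : ∀ n c (f : ℕ → ℤ) → Σ< n (λ i → f i ℤ.* c) ≡ Σ< n f ℤ.* c
Σ<-*ʳ n c f = begin
  Σ< n (λ i → f i ℤ.* c)  ≡⟨ Σ<-cong n (λ i → ℤ.*-comm (f i) c) ⟩
  Σ< n (λ i → c ℤ.* f i)  ≡⟨ Σ<-*ˡ n c f ⟩
  c ℤ.* Σ< n f            ≡⟨ ℤ.*-comm c (Σ< n f) ⟩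
  Σ< n f ℤ.* c            ∎
  where open ≡-Reasoning

Σ<-head : ∀ n (f : ℕ → ℤ) → Σ< (suc n) f ≡ f 0 ℤ.+ Σ< n (λ i → f (suc i))
Σ<-head zero    f = trans (ℤ.+-identityˡ (f 0)) (sym (ℤ.+-identityʳ (f 0)))
Σ<-head (suc n) f = trans (cong (ℤ._+ f (suc n)) (Σ<-head n f)) (ℤ.+-assoc (f 0) _ _)

Σ<-reverse : ∀ n (f : ℕ → ℤ) → Σ< n f ≡ Σ< n (λ i → f (n ∸ suc i))
Σ<-reverse zero    f = refl
Σ<-reverse (suc n) f = begin
  Σ< n f ℤ.+ f n                      ≡⟨ cong (ℤ._+ f n) (Σ<-reverse n f) ⟩
  Σ< n (λ i → f (n ∸ suc i)) ℤ.+ f n  ≡⟨ ℤ.+-comm _ (f n) ⟩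
  f n ℤ.+ Σ< n (λ i → f (n ∸ suc i))  ≡⟨ Σ<-head n (λ i → f (n ∸ i)) ⟨
  Σ< (suc n) (λ i → f (n ∸ i))        ∎
  where open ≡-Reasoning

Σ<-extend : ∀ m N (f : ℕ → ℤ) → m ≤ N → (∀ i → m ≤ i → f i ≡ 0ℤ) → Σ< N f ≡ Σ< m f
Σ<-extend m N f m≤N f≡0 = begin
  Σ< N f              ≡⟨ cong (λ k → Σ< k f) (ℕ.m+[n∸m]≡n m≤N) ⟨
  Σ< (m + (N ∸ m)) f  ≡⟨ padding (N ∸ m) ⟩
  Σ< m f              ∎
  where
  open ≡-Reasoning
  padding : ∀ k → Σ< (m + k) f ≡ Σ< m f
  padding zero    = cong (λ k → Σ< k f) (ℕ.+-identityʳ m)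
  padding (suc k) = begin
    Σ< (m + suc k) f            ≡⟨ cong (λ k → Σ< k f) (ℕ.+-suc m k) ⟩
    Σ< (m + k) f ℤ.+ f (m + k)  ≡⟨ cong₂ ℤ._+_ (padding k) (f≡0 (m + k) (ℕ.m≤m+n m k)) ⟩
    Σ< m f ℤ.+ 0ℤ               ≡⟨ ℤ.+-identityʳ _ ⟩
    Σ< m f                      ∎

Σ<-swap : ∀ n m (F : ℕ → ℕ → ℤ) → Σ< n (λ i → Σ< m (F i)) ≡ Σ< m (λ j → Σ< n (λ i → F i j))
Σ<-swap zero    m F = sym (Σ<-zero m (λ _ _ → refl))
Σ<-swap (suc n) m F = trans (cong (ℤ._+ Σ< m (F n)) (Σ<-swap n m F)) (sym (Σ<-+ m _ _))

Σ<-triangle : ∀ N (F : ℕ → ℕ → ℤ) →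
  Σ< N (λ i → Σ< (suc i) (F i)) ≡ Σ< N (λ j → Σ< (N ∸ j) (λ l → F (j + l) j))
Σ<-triangle zero    F = refl
Σ<-triangle (suc N) F = begin
  Σ< N (λ i → Σ< (suc i) (F i)) ℤ.+ Σ< (suc N) (F N)
    ≡⟨ cong (ℤ._+ Σ< (suc N) (F N)) (Σ<-triangle N F) ⟩
  Σ< N (λ j → Σ< (N ∸ j) (G j)) ℤ.+ Σ< (suc N) (F N)
    ≡⟨ cong (ℤ._+ Σ< (suc N) (F N)) (ℤ.+-identityʳ (Σ< N (λ j → Σ< (N ∸ j) (G j)))) ⟨
  (Σ< N (λ j → Σ< (N ∸ j) (G j)) ℤ.+ 0ℤ) ℤ.+ Σ< (suc N) (F N)
    ≡⟨ cong (λ k → (Σ< N (λ j → Σ< (N ∸ j) (G j)) ℤ.+ Σ< k (G N)) ℤ.+ Σ< (suc N) (F N))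
            (ℕ.n∸n≡0 N) ⟨
  Σ< (suc N) (λ j → Σ< (N ∸ j) (G j)) ℤ.+ Σ< (suc N) (F N)
    ≡⟨ Σ<-+ (suc N) _ _ ⟨
  Σ< (suc N) (λ j → Σ< (N ∸ j) (G j) ℤ.+ F N j)
    ≡⟨ Σ<-cong-< (suc N) lastColumn ⟨
  Σ< (suc N) (λ j → Σ< (suc N ∸ j) (G j))
    ∎
  where
  open ≡-Reasoning
  G : ℕ → ℕ → ℤ
  G j l = F (j + l) j
  lastColumn : ∀ j → j < suc N → Σ< (suc N ∸ j) (G j) ≡ Σ< (N ∸ j) (G j) ℤ.+ F N j
  lastColumn j (s≤s j≤N) = begin
    Σ< (suc N ∸ j) (G j)
      ≡⟨ cong (λ k → Σ< k (G j)) (ℕ.+-∸-assoc 1 j≤N) ⟩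
    Σ< (N ∸ j) (G j) ℤ.+ F (j + (N ∸ j)) j
      ≡⟨ cong (λ k → Σ< (N ∸ j) (G j) ℤ.+ F k j) (ℕ.m+[n∸m]≡n j≤N) ⟩
    Σ< (N ∸ j) (G j) ℤ.+ F N j
      ∎

-- The ring of formal power series

0ₛ : FPS
0ₛ _ = 0ℤ

infix 8 ⊝_
⊝_ : FPS → FPS
(⊝ f) n = - f n

qpow-diag : ∀ e → qpow e e ≡ 1ℤ
qpow-diag e with e ≟ e
... | yes _   = refl
... | no  e≢e = contradiction refl e≢e

qpow-off : ∀ {e n} → e ≢ n → qpow e n ≡ 0ℤ
qpow-off {e} {n} e≢n with e ≟ n
... | yes e≡n = contradiction e≡n e≢n
... | no  _   = refl

qpow-below : ∀ {e n} → n < e → qpow e n ≡ 0ℤ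
qpow-below n<e = qpow-off (λ e≡n → ℕ.<-irrefl (sym e≡n) n<e)

Σ<-qpow-*-out : ∀ N e (g : ℕ → ℤ) → N ≤ e → Σ< N (λ i → qpow e i ℤ.* g i) ≡ 0ℤ
Σ<-qpow-*-out N e g N≤e =
  Σ<-zero N (λ i i<N → cong (ℤ._* g i) (qpow-below (ℕ.<-≤-trans i<N N≤e)))

Σ<-qpow-*-in : ∀ N e (g : ℕ → ℤ) → e < N → Σ< N (λ i → qpow e i ℤ.* g i) ≡ g e
Σ<-qpow-*-in (suc N) e g e<1+N with ℕ.m≤n⇒m<n∨m≡n (ℕ.≤-pred e<1+N)
... | inj₁ e<N = begin
  Σ< N (λ i → qpow e i ℤ.* g i) ℤ.+ qpow e N ℤ.* g N
    ≡⟨ cong₂ (λ x y → x ℤ.+ y ℤ.* g N) (Σ<-qpow-*-in N e g e<N) (qpow-off (ℕ.<⇒≢ e<N)) ⟩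
  g e ℤ.+ 0ℤ ℤ.* g N
    ≡⟨ ℤ.+-identityʳ (g e) ⟩
  g e
    ∎
  where open ≡-Reasoning
... | inj₂ refl = begin
  Σ< e (λ i → qpow e i ℤ.* g i) ℤ.+ qpow e e ℤ.* g e
    ≡⟨ cong₂ (λ x y → x ℤ.+ y ℤ.* g e) (Σ<-qpow-*-out e e g ℕ.≤-refl) (qpow-diag e) ⟩
  0ℤ ℤ.+ 1ℤ ℤ.* g e
    ≡⟨ trans (ℤ.+-identityˡ (1ℤ ℤ.* g e)) (ℤ.*-identityˡ (g e)) ⟩
  g e
    ∎
  where open ≡-Reasoning

qpow-⊗-below : ∀ e f {n} → n < e → (qpow e ⊗ f) n ≡ 0ℤ
qpow-⊗-below e f {n} n<e = Σ<-qpow-*-out (suc n) e _ n<e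

qpow-⊗-shift : ∀ e f m → (qpow e ⊗ f) (e + m) ≡ f m
qpow-⊗-shift e f m = begin
  Σ< (suc (e + m)) (λ i → qpow e i ℤ.* f (e + m ∸ i))
    ≡⟨ Σ<-qpow-*-in (suc (e + m)) e _ (s≤s (ℕ.m≤m+n e m)) ⟩
  f (e + m ∸ e)
    ≡⟨ cong f (ℕ.m+n∸m≡n e m) ⟩
  f m
    ∎
  where open ≡-Reasoning

⊗-comm : ∀ f g → f ⊗ g ≈ g ⊗ f
⊗-comm f g n = begin
  Σ< (suc n) (λ i → f i ℤ.* g (n ∸ i))              ≡⟨ Σ<-reverse (suc n) _ ⟩
  Σ< (suc n) (λ i → f (n ∸ i) ℤ.* g (n ∸ (n ∸ i)))  ≡⟨ Σ<-cong-< (suc n) swapFactors ⟩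
  Σ< (suc n) (λ i → g i ℤ.* f (n ∸ i))              ∎
  where
  open ≡-Reasoning
  swapFactors : ∀ i → i < suc n → f (n ∸ i) ℤ.* g (n ∸ (n ∸ i)) ≡ g i ℤ.* f (n ∸ i)
  swapFactors i (s≤s i≤n) =
    trans (cong (λ j → f (n ∸ i) ℤ.* g j) (ℕ.m∸[m∸n]≡n i≤n)) (ℤ.*-comm (f (n ∸ i)) (g i))

⊗-assoc : ∀ f g h → (f ⊗ g) ⊗ h ≈ f ⊗ (g ⊗ h)
⊗-assoc f g h n = begin
  Σ< (suc n) (λ i → Σ< (suc i) (λ j → f j ℤ.* g (i ∸ j)) ℤ.* h (n ∸ i))
    ≡⟨ Σ<-cong (suc n) (λ i → Σ<-*ʳ (suc i) (h (n ∸ i)) _) ⟨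
  Σ< (suc n) (λ i → Σ< (suc i) (λ j → f j ℤ.* g (i ∸ j) ℤ.* h (n ∸ i)))
    ≡⟨ Σ<-triangle (suc n) (λ i j → f j ℤ.* g (i ∸ j) ℤ.* h (n ∸ i)) ⟩
  Σ< (suc n) (λ j → Σ< (suc n ∸ j) (λ l → f j ℤ.* g (j + l ∸ j) ℤ.* h (n ∸ (j + l))))
    ≡⟨ Σ<-cong-< (suc n) row ⟩
  Σ< (suc n) (λ j → f j ℤ.* Σ< (suc (n ∸ j)) (λ l → g l ℤ.* h (n ∸ j ∸ l)))
    ∎
  where
  open ≡-Reasoning
  row : ∀ j → j < suc n →
    Σ< (suc n ∸ j) (λ l → f j ℤ.* g (j + l ∸ j) ℤ.* h (n ∸ (j + l)))
    ≡ f j ℤ.* Σ< (suc (n ∸ j)) (λ l → g l ℤ.* h (n ∸ j ∸ l))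
  row j (s≤s j≤n) = begin
    Σ< (suc n ∸ j) (λ l → f j ℤ.* g (j + l ∸ j) ℤ.* h (n ∸ (j + l)))
      ≡⟨ cong (λ k → Σ< k (λ l → f j ℤ.* g (j + l ∸ j) ℤ.* h (n ∸ (j + l)))) (ℕ.+-∸-assoc 1 j≤n) ⟩
    Σ< (suc (n ∸ j)) (λ l → f j ℤ.* g (j + l ∸ j) ℤ.* h (n ∸ (j + l)))
      ≡⟨ Σ<-cong (suc (n ∸ j)) (λ l → trans (ℤ.*-assoc (f j) _ _)
           (cong₂ (λ a b → f j ℤ.* (g a ℤ.* h b)) (ℕ.m+n∸m≡n j l) (sym (ℕ.∸-+-assoc n j l)))) ⟩
    Σ< (suc (n ∸ j)) (λ l → f j ℤ.* (g l ℤ.* h (n ∸ j ∸ l)))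
      ≡⟨ Σ<-*ˡ (suc (n ∸ j)) (f j) _ ⟩
    f j ℤ.* Σ< (suc (n ∸ j)) (λ l → g l ℤ.* h (n ∸ j ∸ l))
      ∎

⊗-distribˡ-⊕ : ∀ f g h → f ⊗ (g ⊕ h) ≈ f ⊗ g ⊕ f ⊗ h
⊗-distribˡ-⊕ f g h n =
  trans (Σ<-cong (suc n) (λ i → ℤ.*-distribˡ-+ (f i) _ _)) (Σ<-+ (suc n) _ _)

⊗-identityˡ : ∀ f → one ⊗ f ≈ f
⊗-identityˡ f = qpow-⊗-shift 0 f

⊗-cong : ∀ {f f′ g g′} → f ≈ f′ → g ≈ g′ → f ⊗ g ≈ f′ ⊗ g′
⊗-cong f≈f′ g≈g′ n = Σ<-cong (suc n) (λ i → cong₂ ℤ._*_ (f≈f′ i) (g≈g′ (n ∸ i)))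

⊗-congˡ : ∀ f {g g′} → g ≈ g′ → f ⊗ g ≈ f ⊗ g′
⊗-congˡ f = ⊗-cong {f} {f} (λ _ → refl)

⊗-congʳ : ∀ g {f f′} → f ≈ f′ → f ⊗ g ≈ f′ ⊗ g
⊗-congʳ g f≈f′ = ⊗-cong {g = g} {g} f≈f′ (λ _ → refl)

⊕-cong : ∀ {f f′ g g′} → f ≈ f′ → g ≈ g′ → f ⊕ g ≈ f′ ⊕ g′
⊕-cong f≈f′ g≈g′ n = cong₂ ℤ._+_ (f≈f′ n) (g≈g′ n)

⊖-cong : ∀ {f f′ g g′} → f ≈ f′ → g ≈ g′ → f ⊖ g ≈ f′ ⊖ g′
⊖-cong f≈f′ g≈g′ n = cong₂ _-_ (f≈f′ n) (g≈g′ n)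

·-⊗-assoc : ∀ c f g → (c · f) ⊗ g ≈ c · (f ⊗ g)
·-⊗-assoc c f g n = trans (Σ<-cong (suc n) (λ i → ℤ.*-assoc c (f i) _)) (Σ<-*ˡ (suc n) c _)

⊗-·-comm : ∀ c f g → f ⊗ (c · g) ≈ c · (f ⊗ g)
⊗-·-comm c f g n = trans (Σ<-cong (suc n) (λ i → swap (f i) c (g (n ∸ i)))) (Σ<-*ˡ (suc n) c _)
  where
  swap : ∀ x c y → x ℤ.* (c ℤ.* y) ≡ c ℤ.* (x ℤ.* y)
  swap = ℤ-Solver.solve-∀

⊗-const : ∀ f g → f 0 ≡ 1ℤ → g 0 ≡ 1ℤ → (f ⊗ g) 0 ≡ 1ℤ
⊗-const f g f₀≡1 g₀≡1 = trans (ℤ.+-identityˡ (f 0 ℤ.* g 0)) (cong₂ ℤ._*_ f₀≡1 g₀≡1)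

FPS-commutativeRing : CommutativeRing _ _
FPS-commutativeRing = record
  { Carrier = FPS ; _≈_ = _≈_ ; _+_ = _⊕_ ; _*_ = _⊗_ ; -_ = ⊝_ ; 0# = 0ₛ ; 1# = one
  ; isCommutativeRing = record
    { isRing = record
      { +-isAbelianGroup = record
        { isGroup = record
          { isMonoid = record
            { isSemigroup = record
              { isMagma = record
                { isEquivalence = record
                  { refl = λ _ → refl ; sym = λ p n → sym (p n) ; trans = λ p q n → trans (p n) (q n) }
                ; ∙-cong = ⊕-cong }
              ; assoc = λ f g h n → ℤ.+-assoc (f n) (g n) (h n) }
            ; identity = (λ f n → ℤ.+-identityˡ (f n)) , (λ f n → ℤ.+-identityʳ (f n)) }
          ; inverse = (λ f n → ℤ.+-inverseˡ (f n)) , (λ f n → ℤ.+-inverseʳ (f n))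
          ; ⁻¹-cong = λ p n → cong -_ (p n) }
        ; comm = λ f g n → ℤ.+-comm (f n) (g n) }
      ; *-cong = ⊗-cong
      ; *-assoc = ⊗-assoc
      ; *-identity = ⊗-identityˡ , λ f n → trans (⊗-comm f one n) (⊗-identityˡ f n)
      ; distrib = ⊗-distribˡ-⊕ , λ f g h n → trans (⊗-comm (g ⊕ h) f n)
                    (trans (⊗-distribˡ-⊕ f g h n) (cong₂ ℤ._+_ (⊗-comm f g n) (⊗-comm f h n)))
      }
    ; *-comm = ⊗-comm }
  }

module FPS-Solver where
  private
    FPS-almostCommutativeRing : ACR.AlmostCommutativeRing _ _
    FPS-almostCommutativeRing = ACR.fromCommutativeRing FPS-commutativeRing

    constants : ACR._-Raw-AlmostCommutative⟶_ ℤ.+-*-rawRing FPS-almostCommutativeRing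
    constants = record
      { ⟦_⟧    = λ c → c · one
      ; +-homo = λ c d n → ℤ.*-distribʳ-+ (one n) c d
      ; *-homo = λ c d n → sym (trans (·-⊗-assoc c one (d · one) n)
                   (trans (cong (ℤ._*_ c) (⊗-identityˡ (d · one) n)) (sym (ℤ.*-assoc c d (one n)))))
      ; -‿homo = λ c n → sym (ℤ.neg-distribˡ-* c (one n))
      ; 0-homo = λ n → ℤ.*-zeroˡ (one n)
      ; 1-homo = λ n → ℤ.*-identityˡ (one n)
      }

    constants-≟ : ∀ c d → Maybe (c · one ≈ d · one)
    constants-≟ c d with c ℤ.≟ d
    ... | yes refl = just (λ _ → refl)
    ... | no  _    = nothing

  open Algebra.Solver.Ring ℤ.+-*-rawRing FPS-almostCommutativeRing constants constants-≟ public

open FPS-Solver using (solve; _:*_; _:-_; _:+_; _:=_)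
open CommutativeRing FPS-commutativeRing
  using (setoid; reflexive; *-identityʳ; *-assoc) renaming (refl to ≈-refl; sym to ≈-sym; trans to ≈-trans)

qpow-shift : ∀ m e d → qpow (m + e) (m + d) ≡ qpow e d
qpow-shift m e d = shifted (e ≟ d)
  where
  shifted : ∀ {d} → Dec (e ≡ d) → qpow (m + e) (m + d) ≡ qpow e d
  shifted (yes refl) = trans (qpow-diag (m + e)) (sym (qpow-diag e))
  shifted (no  e≢d)  = trans (qpow-off (e≢d ∘ ℕ.+-cancelˡ-≡ m _ _)) (sym (qpow-off e≢d))

qpow-+ : ∀ m n → qpow (m + n) ≈ qpow m ⊗ qpow n
qpow-+ m n c with c ℕ.<? m
... | yes c<m = trans (qpow-below (ℕ.<-≤-trans c<m (ℕ.m≤m+n m n))) (sym (qpow-⊗-below m (qpow n) c<m))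
... | no  c≮m = subst (λ c → qpow (m + n) c ≡ (qpow m ⊗ qpow n) c) (ℕ.m+[n∸m]≡n (ℕ.≮⇒≥ c≮m))
  (trans (qpow-shift m n (c ∸ m)) (sym (qpow-⊗-shift m (qpow n) (c ∸ m))))

-- Inverses of series with constant term 1

length-invRev : ∀ f m → length (invRev f m) ≡ suc m
length-invRev f zero    = refl
length-invRev f (suc m) = cong suc (length-invRev f m)

foldr-zipWith-invRev : ∀ f (h : ℕ → ℤ) m →
  foldr ℤ._+_ 0ℤ (zipWith ℤ._*_ (applyUpTo h (suc m)) (invRev f m))
  ≡ Σ< (suc m) (λ i → h i ℤ.* inv f (m ∸ i))
foldr-zipWith-invRev f h zero    = trans (ℤ.+-identityʳ (h 0 ℤ.* 1ℤ)) (sym (ℤ.+-identityˡ (h 0 ℤ.* 1ℤ)))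
foldr-zipWith-invRev f h (suc m) =
  trans (cong (ℤ._+_ (h 0 ℤ.* inv f (suc m))) (foldr-zipWith-invRev f (h ∘ suc) m))
        (sym (Σ<-head (suc m) (λ i → h i ℤ.* inv f (suc m ∸ i))))

inv-suc : ∀ f m → inv f (suc m) ≡ - Σ< (suc m) (λ i → f (suc i) ℤ.* inv f (m ∸ i))
inv-suc f m = cong -_ (begin
  foldr ℤ._+_ 0ℤ (zipWith ℤ._*_ (map (f ∘ suc) (upTo (length (invRev f m)))) (invRev f m))
    ≡⟨ cong (λ l → foldr ℤ._+_ 0ℤ (zipWith ℤ._*_ (map (f ∘ suc) (upTo l)) (invRev f m)))
            (length-invRev f m) ⟩
  foldr ℤ._+_ 0ℤ (zipWith ℤ._*_ (map (f ∘ suc) (upTo (suc m))) (invRev f m))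
    ≡⟨ cong (λ l → foldr ℤ._+_ 0ℤ (zipWith ℤ._*_ l (invRev f m))) (map-upTo (f ∘ suc) (suc m)) ⟩
  foldr ℤ._+_ 0ℤ (zipWith ℤ._*_ (applyUpTo (f ∘ suc) (suc m)) (invRev f m))
    ≡⟨ foldr-zipWith-invRev f (f ∘ suc) m ⟩
  Σ< (suc m) (λ i → f (suc i) ℤ.* inv f (m ∸ i))
    ∎)
  where open ≡-Reasoning

⊗-inverseʳ : ∀ f → f 0 ≡ 1ℤ → f ⊗ inv f ≈ one
⊗-inverseʳ f f₀≡1 zero    = trans (ℤ.+-identityˡ _) (cong (ℤ._* 1ℤ) f₀≡1)
⊗-inverseʳ f f₀≡1 (suc m) = begin
  Σ< (suc (suc m)) (λ i → f i ℤ.* inv f (suc m ∸ i))  ≡⟨ Σ<-head (suc m) _ ⟩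
  f 0 ℤ.* inv f (suc m) ℤ.+ X                         ≡⟨ cong₂ (λ a b → a ℤ.* b ℤ.+ X) f₀≡1 (inv-suc f m) ⟩
  1ℤ ℤ.* - X ℤ.+ X                                    ≡⟨ cong (ℤ._+ X) (ℤ.*-identityˡ (- X)) ⟩
  - X ℤ.+ X                                           ≡⟨ ℤ.+-inverseˡ X ⟩
  0ℤ                                                  ∎
  where
  open ≡-Reasoning
  X = Σ< (suc m) (λ i → f (suc i) ℤ.* inv f (m ∸ i))

⊗-inverseˡ : ∀ f → f 0 ≡ 1ℤ → inv f ⊗ f ≈ one
⊗-inverseˡ f f₀≡1 = ≈-trans (⊗-comm (inv f) f) (⊗-inverseʳ f f₀≡1)

⊗-cancelʳ : ∀ d {f g} → d 0 ≡ 1ℤ → f ⊗ d ≈ g ⊗ d → f ≈ g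
⊗-cancelʳ d {f} {g} d₀≡1 fd≈gd = begin
  f                ≈⟨ *-identityʳ f ⟨
  f ⊗ one          ≈⟨ ⊗-congˡ f (⊗-inverseʳ d d₀≡1) ⟨
  f ⊗ (d ⊗ inv d)  ≈⟨ *-assoc f d (inv d) ⟨
  f ⊗ d ⊗ inv d    ≈⟨ ⊗-congʳ (inv d) fd≈gd ⟩
  g ⊗ d ⊗ inv d    ≈⟨ *-assoc g d (inv d) ⟩
  g ⊗ (d ⊗ inv d)  ≈⟨ ⊗-congˡ g (⊗-inverseʳ d d₀≡1) ⟩
  g ⊗ one          ≈⟨ *-identityʳ g ⟩
  g                ∎
  where open SetoidReasoning setoid

inv-unique : ∀ d {f} → d 0 ≡ 1ℤ → f ⊗ d ≈ one → f ≈ inv d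
inv-unique d d₀≡1 fd≈1 = ⊗-cancelʳ d d₀≡1 (≈-trans fd≈1 (≈-sym (⊗-inverseˡ d d₀≡1)))

clear-denominator : ∀ x d e → d 0 ≡ 1ℤ → (x ⊗ inv d) ⊗ (d ⊗ e) ≈ x ⊗ e
clear-denominator x d e d₀≡1 = begin
  (x ⊗ inv d) ⊗ (d ⊗ e)  ≈⟨ solve 4 (λ x i d e → (x :* i) :* (d :* e) := (x :* e) :* (i :* d))
                                     ≈-refl x (inv d) d e ⟩
  (x ⊗ e) ⊗ (inv d ⊗ d)  ≈⟨ ⊗-congˡ (x ⊗ e) (⊗-inverseˡ d d₀≡1) ⟩
  (x ⊗ e) ⊗ one          ≈⟨ *-identityʳ (x ⊗ e) ⟩
  x ⊗ e                  ∎
  where open SetoidReasoning setoid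

-- Congruences modulo powers of q

infix 4 _≈[_]_
_≈[_]_ : FPS → ℕ → FPS → Set
f ≈[ b ] g = ∀ n → n < b → f n ≡ g n

≈[]-mono : ∀ {b c f g} → c ≤ b → f ≈[ b ] g → f ≈[ c ] g
≈[]-mono c≤b f≈g n n<c = f≈g n (ℕ.<-≤-trans n<c c≤b)

⊗-cong-≈[] : ∀ {b f f′ g g′} → f ≈[ b ] f′ → g ≈[ b ] g′ → f ⊗ g ≈[ b ] f′ ⊗ g′
⊗-cong-≈[] f≈f′ g≈g′ n n<b = Σ<-cong-< (suc n) (λ i i<1+n →
  cong₂ ℤ._*_ (f≈f′ i (ℕ.≤-<-trans (ℕ.≤-pred i<1+n) n<b))
              (g≈g′ (n ∸ i) (ℕ.≤-<-trans (ℕ.m∸n≤m n i) n<b)))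

qpow-≈[]-0 : ∀ e → qpow e ≈[ e ] 0ₛ
qpow-≈[]-0 e n = qpow-below

qpow-⊗-≈[]-0 : ∀ e f → qpow e ⊗ f ≈[ e ] 0ₛ
qpow-⊗-≈[]-0 e f n = qpow-⊗-below e f

qpow-⊗-cong-≈[] : ∀ e {b f g} → f ≈[ b ] g → qpow e ⊗ f ≈[ e + b ] qpow e ⊗ g
qpow-⊗-cong-≈[] e {b} {f} {g} f≈g n n<e+b with n ℕ.<? e
... | yes n<e = trans (qpow-⊗-below e f n<e) (sym (qpow-⊗-below e g n<e))
... | no  n≮e = subst (λ n → (qpow e ⊗ f) n ≡ (qpow e ⊗ g) n) e+[n∸e]≡n (begin
  (qpow e ⊗ f) (e + (n ∸ e))  ≡⟨ qpow-⊗-shift e f (n ∸ e) ⟩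
  f (n ∸ e)                   ≡⟨ f≈g (n ∸ e) n∸e<b ⟩
  g (n ∸ e)                   ≡⟨ qpow-⊗-shift e g (n ∸ e) ⟨
  (qpow e ⊗ g) (e + (n ∸ e))  ∎)
  where
  open ≡-Reasoning
  e+[n∸e]≡n : e + (n ∸ e) ≡ n
  e+[n∸e]≡n = ℕ.m+[n∸m]≡n (ℕ.≮⇒≥ n≮e)
  n∸e<b : n ∸ e < b
  n∸e<b = ℕ.+-cancelˡ-< e (n ∸ e) b (subst (_< e + b) (sym e+[n∸e]≡n) n<e+b)

·-≈[]-0 : ∀ c {b f} → f ≈[ b ] 0ₛ → c · f ≈[ b ] 0ₛ
·-≈[]-0 c f≈0 n n<b = trans (cong (ℤ._*_ c) (f≈0 n n<b)) (ℤ.*-zeroʳ c)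

1⊖qpow-≈[]-one : ∀ {b} e → b ≤ e → one ⊖ qpow e ≈[ b ] one
1⊖qpow-≈[]-one e b≤e n n<b =
  trans (cong (λ x → one n - x) (qpow-below (ℕ.<-≤-trans n<b b≤e))) (ℤ.+-identityʳ (one n))

⊗-1⊖qpow-≈[] : ∀ f e → f ⊗ (one ⊖ qpow e) ≈[ e ] f
⊗-1⊖qpow-≈[] f e n n<e =
  trans (⊗-cong-≈[] {f′ = f} (λ _ _ → refl) (1⊖qpow-≈[]-one e ℕ.≤-refl) n n<e) (*-identityʳ f n)

-- q-Pochhammer symbols

poch-≈[]-one : ∀ a d j → poch a d j ≈[ a ] one
poch-≈[]-one a d zero    n n<a = refl
poch-≈[]-one a d (suc j) n n<a = trans
  (⊗-cong-≈[] (poch-≈[]-one a d j) (1⊖qpow-≈[]-one (a + d * j) (ℕ.m≤m+n a _)) n n<a)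
  (⊗-identityˡ one n)

poch-const : ∀ a d j → 1 ≤ a → poch a d j 0 ≡ 1ℤ
poch-const a d j 1≤a = poch-≈[]-one a d j 0 1≤a

poch-suc-head : ∀ a d j → poch a d (suc j) ≈ (one ⊖ qpow a) ⊗ poch (a + d) d j
poch-suc-head a d zero = begin
  one ⊗ (one ⊖ qpow (a + d * 0))  ≈⟨ ⊗-comm one (one ⊖ qpow (a + d * 0)) ⟩
  (one ⊖ qpow (a + d * 0)) ⊗ one  ≈⟨ reflexive (cong (λ e → (one ⊖ qpow e) ⊗ one) (a+d*0≡a a d)) ⟩
  (one ⊖ qpow a) ⊗ one            ∎
  where
  open SetoidReasoning setoid
  a+d*0≡a : ∀ a d → a + d * 0 ≡ a
  a+d*0≡a = ℕ-Solver.solve-∀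
poch-suc-head a d (suc j) = begin
  poch a d (suc j) ⊗ (one ⊖ qpow (a + d * suc j))
    ≈⟨ ⊗-congʳ (one ⊖ qpow (a + d * suc j)) (poch-suc-head a d j) ⟩
  (one ⊖ qpow a) ⊗ poch (a + d) d j ⊗ (one ⊖ qpow (a + d * suc j))
    ≈⟨ *-assoc (one ⊖ qpow a) (poch (a + d) d j) (one ⊖ qpow (a + d * suc j)) ⟩
  (one ⊖ qpow a) ⊗ (poch (a + d) d j ⊗ (one ⊖ qpow (a + d * suc j)))
    ≈⟨ reflexive (cong (λ e → (one ⊖ qpow a) ⊗ (poch (a + d) d j ⊗ (one ⊖ qpow e))) (exponent a d j)) ⟩
  (one ⊖ qpow a) ⊗ poch (a + d) d (suc j)
    ∎
  where
  open SetoidReasoning setoid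
  exponent : ∀ a d j → a + d * suc j ≡ a + d + d * j
  exponent = ℕ-Solver.solve-∀

poch-stable : ∀ {a d} → 1 ≤ d → ∀ m {n} → n < m → poch a d m n ≡ pochInf a d n
poch-stable {a} {d} 1≤d (suc m) {n} n<1+m with ℕ.m≤n⇒m<n∨m≡n (ℕ.≤-pred n<1+m)
... | inj₂ refl = refl
... | inj₁ n<m  = trans (⊗-1⊖qpow-≈[] (poch a d m) (a + d * m) n n<a+d*m) (poch-stable 1≤d m n<m)
  where
  n<a+d*m : n < a + d * m
  n<a+d*m = ℕ.<-≤-trans n<m (ℕ.≤-trans (ℕ.m≤n*m m d {{ℕ.>-nonZero 1≤d}}) (ℕ.m≤n+m (d * m) a))

pochInf-suc-head : ∀ a {d} → 1 ≤ d → pochInf a d ≈ (one ⊖ qpow a) ⊗ pochInf (a + d) d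
pochInf-suc-head a {d} 1≤d n = begin
  pochInf a d n
    ≡⟨ poch-stable 1≤d (suc (suc n)) (ℕ.m<n⇒m<1+n (ℕ.n<1+n n)) ⟨
  poch a d (suc (suc n)) n
    ≡⟨ poch-suc-head a d (suc n) n ⟩
  ((one ⊖ qpow a) ⊗ poch (a + d) d (suc n)) n
    ≡⟨ ⊗-cong-≈[] {f′ = one ⊖ qpow a} (λ _ _ → refl) (λ k → poch-stable {a + d} 1≤d (suc n) {k})
                  n (ℕ.n<1+n n) ⟩
  ((one ⊖ qpow a) ⊗ pochInf (a + d) d) n
    ∎
  where open ≡-Reasoning

pochInf-≈[]-one : ∀ a d → pochInf a d ≈[ a ] one
pochInf-≈[]-one a d n = poch-≈[]-one a d (suc n) n

-- Infinite sums

Summable : (ℕ → FPS) → Set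
Summable T = ∀ j → T j ≈[ j ] 0ₛ

qpow-⊗-summable : ∀ (e : ℕ → ℕ) (f : ℕ → FPS) → (∀ j → j ≤ e j) →
  Summable (λ j → qpow (e j) ⊗ f j)
qpow-⊗-summable e f j≤e j = ≈[]-mono (j≤e j) (qpow-⊗-≈[]-0 (e j) (f j))

summable-suc : ∀ T → Summable T → Summable (T ∘ suc)
summable-suc T T-summable j = ≈[]-mono (ℕ.n≤1+n j) (T-summable (suc j))

summable-⊖ : ∀ T U → Summable T → Summable U → Summable (λ j → T j ⊖ U j)
summable-⊖ T U T-summable U-summable j n n<j =
  cong₂ _-_ (T-summable j n n<j) (U-summable j n n<j)

sumInf-cong : ∀ {T U} → (∀ j → T j ≈ U j) → sumInf T ≈ sumInf U
sumInf-cong T≈U n = Σ<-cong (suc n) (λ j → T≈U j n)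

sumInf-⊝ : ∀ T → sumInf (λ j → ⊝ T j) ≈ ⊝ sumInf T
sumInf-⊝ T n = Σ<-neg (suc n) (λ j → T j n)

sumInf-⊖ : ∀ T U → sumInf (λ j → T j ⊖ U j) ≈ sumInf T ⊖ sumInf U
sumInf-⊖ T U n =
  trans (Σ<-+ (suc n) (λ j → T j n) (λ j → - U j n)) (cong (ℤ._+_ (sumInf T n)) (sumInf-⊝ U n))

sumInf-head : ∀ T → Summable T → sumInf T ≈ T 0 ⊕ sumInf (T ∘ suc)
sumInf-head T T-summable n = begin
  Σ< (suc n) (λ j → T j n)
    ≡⟨ Σ<-head n (λ j → T j n) ⟩
  T 0 n ℤ.+ Σ< n (λ j → T (suc j) n)
    ≡⟨ cong (ℤ._+_ (T 0 n)) (ℤ.+-identityʳ _) ⟨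
  T 0 n ℤ.+ (Σ< n (λ j → T (suc j) n) ℤ.+ 0ℤ)
    ≡⟨ cong (λ x → T 0 n ℤ.+ (Σ< n (λ j → T (suc j) n) ℤ.+ x)) (T-summable (suc n) n (ℕ.n<1+n n)) ⟨
  T 0 n ℤ.+ (Σ< n (λ j → T (suc j) n) ℤ.+ T (suc n) n)
    ∎
  where open ≡-Reasoning

sumInf-≈[]-head : ∀ {b} T → (∀ j → T (suc j) ≈[ b ] 0ₛ) → sumInf T ≈[ b ] T 0
sumInf-≈[]-head T tail≈0 n n<b = begin
  Σ< (suc n) (λ j → T j n)            ≡⟨ Σ<-head n (λ j → T j n) ⟩
  T 0 n ℤ.+ Σ< n (λ j → T (suc j) n)  ≡⟨ cong (ℤ._+_ (T 0 n)) (Σ<-zero n (λ j _ → tail≈0 j n n<b)) ⟩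
  T 0 n ℤ.+ 0ℤ                        ≡⟨ ℤ.+-identityʳ (T 0 n) ⟩
  T 0 n                               ∎
  where open ≡-Reasoning

⊗-sumInf : ∀ f T → Summable T → f ⊗ sumInf T ≈ sumInf (λ j → f ⊗ T j)
⊗-sumInf f T T-summable n = begin
  Σ< (suc n) (λ i → f i ℤ.* Σ< (suc (n ∸ i)) (λ j → T j (n ∸ i)))
    ≡⟨ Σ<-cong (suc n) (λ i → cong (ℤ._*_ (f i)) (sym (Σ<-extend (suc (n ∸ i)) (suc n) _
         (s≤s (ℕ.m∸n≤m n i)) (λ j n∸i<j → T-summable j (n ∸ i) n∸i<j)))) ⟩
  Σ< (suc n) (λ i → f i ℤ.* Σ< (suc n) (λ j → T j (n ∸ i)))
    ≡⟨ Σ<-cong (suc n) (λ i → sym (Σ<-*ˡ (suc n) (f i) _)) ⟩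
  Σ< (suc n) (λ i → Σ< (suc n) (λ j → f i ℤ.* T j (n ∸ i)))
    ≡⟨ Σ<-swap (suc n) (suc n) _ ⟩
  Σ< (suc n) (λ j → Σ< (suc n) (λ i → f i ℤ.* T j (n ∸ i)))
    ∎
  where open ≡-Reasoning

-- The equation for X x determines its coefficients below b + 1 from those of
-- X (σ x) below b.
functional-equation-unique : ∀ {A : Set} (σ : A → A) (e : A → ℕ) (g X Y : A → FPS) →
  (∀ x → X x ≈ g x ⊖ qpow (suc (e x)) ⊗ X (σ x)) →
  (∀ x → Y x ≈ g x ⊖ qpow (suc (e x)) ⊗ Y (σ x)) →
  ∀ x → X x ≈ Y x
functional-equation-unique σ e g X Y X-eq Y-eq x n = agree (suc n) x n (ℕ.n<1+n n)
  where
  agree : ∀ b x → X x ≈[ b ] Y x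
  agree zero    x n ()
  agree (suc b) x n n<1+b = begin
    X x n
      ≡⟨ X-eq x n ⟩
    g x n - (qpow (suc (e x)) ⊗ X (σ x)) n
      ≡⟨ cong (λ y → g x n - y) (qpow-⊗-cong-≈[] (suc (e x)) (agree b (σ x)) n
                                   (ℕ.<-≤-trans n<1+b (s≤s (ℕ.m≤n+m b (e x))))) ⟩
    g x n - (qpow (suc (e x)) ⊗ Y (σ x)) n
      ≡⟨ Y-eq x n ⟨
    Y x n
      ∎
    where open ≡-Reasoning

shift-invariant-≈ : ∀ (F : ℕ → FPS) g →
  (∀ m → F m ≈ F (suc m)) → (∀ m → F m ≈[ m ] g) → F 0 ≈ g
shift-invariant-≈ F g F-invariant F≈g n = trans (invariant (suc n) n) (F≈g (suc n) n (ℕ.n<1+n n))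
  where
  invariant : ∀ m → F 0 ≈ F m
  invariant zero    = ≈-refl
  invariant (suc m) = ≈-trans (invariant m) (F-invariant m)

-- The right-hand side

T : ℕ → ℕ → FPS
T a j = qpow (j * (2 * j + a)) ⊗ inv (poch 2 2 j ⊗ poch a 2 j)

S : ℕ → FPS
S a = sumInf (T a)

R : ℕ → FPS
R a = pochInf a 2 ⊗ S a

T-denominator-const : ∀ a j → 1 ≤ a → (poch 2 2 j ⊗ poch a 2 j) 0 ≡ 1ℤ
T-denominator-const a j 1≤a =
  ⊗-const (poch 2 2 j) (poch a 2 j) (poch-const 2 2 j (s≤s z≤n)) (poch-const a 2 j 1≤a)

T-summable : ∀ a → Summable (T a)
T-summable a =
  qpow-⊗-summable (λ j → j * (2 * j + a)) (λ j → inv (poch 2 2 j ⊗ poch a 2 j)) j≤exponent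
  where
  j≤exponent : ∀ j → j ≤ j * (2 * j + a)
  j≤exponent zero    = z≤n
  j≤exponent (suc j) = ℕ.m≤m*n (suc j) (2 * suc j + a)

T-head : ∀ a → T a 0 ≈ one
T-head a =
  ≈-trans (⊗-identityˡ (inv (one ⊗ one))) (≈-sym (inv-unique (one ⊗ one) refl one⊗[one⊗one]≈one))
  where
  one⊗[one⊗one]≈one : one ⊗ (one ⊗ one) ≈ one
  one⊗[one⊗one]≈one = ≈-trans (⊗-identityˡ (one ⊗ one)) (⊗-identityˡ one)

-- M is a common multiple of the denominators D₁, D₂, D₃ of the three terms
-- of T-step; multiplying by it reduces T-step to the identity numerators.
module _ (a i : ℕ) (1≤a : 1 ≤ a) where
  private
    x₁ x₂ x₃ y u v z₀ z₂ D₁ D₂ D₃ M : FPS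
    x₁ = qpow (suc i * (2 * suc i + a))
    x₂ = qpow (suc i * (2 * suc i + (a + 2)))
    x₃ = qpow (i * (2 * i + (a + 4)))
    y  = qpow (2 + 2 * i)
    u  = one ⊖ qpow (a + 2 * suc i)
    v  = one ⊖ y
    z₀ = one ⊖ qpow a
    z₂ = one ⊖ qpow (a + 2)
    D₁ = poch 2 2 (suc i) ⊗ poch a 2 (suc i)
    D₂ = poch 2 2 (suc i) ⊗ poch (a + 2) 2 (suc i)
    D₃ = poch 2 2 i ⊗ poch (a + 4) 2 i
    M  = D₁ ⊗ u

    M-const : M 0 ≡ 1ℤ
    M-const = ⊗-const D₁ u (T-denominator-const a (suc i) 1≤a)
      (1⊖qpow-≈[]-one (a + 2 * suc i) (ℕ.≤-trans 1≤a (ℕ.m≤m+n a _)) 0 (s≤s z≤n))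

    M≈D₂⊗z₀ : M ≈ D₂ ⊗ z₀
    M≈D₂⊗z₀ = begin
      poch 2 2 (suc i) ⊗ poch a 2 (suc i) ⊗ u
        ≈⟨ *-assoc (poch 2 2 (suc i)) (poch a 2 (suc i)) u ⟩
      poch 2 2 (suc i) ⊗ poch a 2 (suc (suc i))
        ≈⟨ ⊗-congˡ (poch 2 2 (suc i)) (poch-suc-head a 2 (suc i)) ⟩
      poch 2 2 (suc i) ⊗ (z₀ ⊗ poch (a + 2) 2 (suc i))
        ≈⟨ solve 3 (λ q z p → q :* (z :* p) := q :* p :* z)
                 ≈-refl (poch 2 2 (suc i)) z₀ (poch (a + 2) 2 (suc i)) ⟩
      D₂ ⊗ z₀
        ∎
      where open SetoidReasoning setoid

    D₂≈D₃⊗v⊗z₂ : D₂ ≈ D₃ ⊗ (v ⊗ z₂)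
    D₂≈D₃⊗v⊗z₂ = begin
      poch 2 2 i ⊗ v ⊗ poch (a + 2) 2 (suc i)
        ≈⟨ ⊗-congˡ (poch 2 2 i ⊗ v) (poch-suc-head (a + 2) 2 i) ⟩
      poch 2 2 i ⊗ v ⊗ (z₂ ⊗ poch (a + 2 + 2) 2 i)
        ≈⟨ reflexive (cong (λ b → poch 2 2 i ⊗ v ⊗ (z₂ ⊗ poch b 2 i)) (ℕ.+-assoc a 2 2)) ⟩
      poch 2 2 i ⊗ v ⊗ (z₂ ⊗ poch (a + 4) 2 i)
        ≈⟨ solve 4 (λ q v z p → q :* v :* (z :* p) := q :* p :* (v :* z))
                 ≈-refl (poch 2 2 i) v z₂ (poch (a + 4) 2 i) ⟩
      D₃ ⊗ (v ⊗ z₂)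
        ∎
      where open SetoidReasoning setoid

    T₁-cleared : T a (suc i) ⊗ M ≈ x₁ ⊗ u
    T₁-cleared = clear-denominator x₁ D₁ u (T-denominator-const a (suc i) 1≤a)

    T₂-cleared : T (a + 2) (suc i) ⊗ M ≈ x₂ ⊗ z₀
    T₂-cleared = ≈-trans (⊗-congˡ (T (a + 2) (suc i)) M≈D₂⊗z₀)
      (clear-denominator x₂ D₂ z₀ (T-denominator-const (a + 2) (suc i) (ℕ.≤-trans 1≤a (ℕ.m≤m+n a 2))))

    T₃-cleared : T (a + 4) i ⊗ M ≈ x₃ ⊗ (v ⊗ z₂ ⊗ z₀)
    T₃-cleared = ≈-trans (⊗-congˡ (T (a + 4) i) M≈D₃⊗[v⊗z₂⊗z₀])
      (clear-denominator x₃ D₃ (v ⊗ z₂ ⊗ z₀)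
        (T-denominator-const (a + 4) i (ℕ.≤-trans 1≤a (ℕ.m≤m+n a 4))))
      where
      M≈D₃⊗[v⊗z₂⊗z₀] : M ≈ D₃ ⊗ (v ⊗ z₂ ⊗ z₀)
      M≈D₃⊗[v⊗z₂⊗z₀] =
        ≈-trans M≈D₂⊗z₀ (≈-trans (⊗-congʳ z₀ D₂≈D₃⊗v⊗z₂) (*-assoc D₃ (v ⊗ z₂) z₀))

    numerators : x₁ ⊗ u ⊖ x₂ ⊗ z₀ ≈ qpow (a + 2) ⊗ x₃ ⊗ v
    numerators = begin
      x₁ ⊗ u ⊖ x₂ ⊗ z₀
        ≈⟨ ⊖-cong (⊗-congˡ x₁ (⊖-cong {one} {one} ≈-refl u-exponent)) (⊗-congʳ z₀ x₂-exponent) ⟩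
      x₁ ⊗ (one ⊖ qpow a ⊗ y) ⊖ x₁ ⊗ y ⊗ (one ⊖ qpow a)
        ≈⟨ solve 4 (λ o x z y → x :* (o :- z :* y) :- x :* y :* (o :- z) := x :* (o :- y :* o))
                 ≈-refl one x₁ (qpow a) y ⟩
      x₁ ⊗ (one ⊖ y ⊗ one)
        ≈⟨ ⊗-congˡ x₁ (⊖-cong {one} {one} ≈-refl (*-identityʳ y)) ⟩
      x₁ ⊗ v
        ≈⟨ ⊗-congʳ v x₁-exponent ⟩
      qpow (a + 2) ⊗ x₃ ⊗ v
        ∎
      where
      open SetoidReasoning setoid
      u-exponent : qpow (a + 2 * suc i) ≈ qpow a ⊗ y
      u-exponent = ≈-trans (reflexive (cong qpow (e₁ a i))) (qpow-+ a (2 + 2 * i))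
        where
        e₁ : ∀ a i → a + 2 * suc i ≡ a + (2 + 2 * i)
        e₁ = ℕ-Solver.solve-∀
      x₂-exponent : x₂ ≈ x₁ ⊗ y
      x₂-exponent = ≈-trans (reflexive (cong qpow (e₂ a i))) (qpow-+ (suc i * (2 * suc i + a)) (2 + 2 * i))
        where
        e₂ : ∀ a i → suc i * (2 * suc i + (a + 2)) ≡ suc i * (2 * suc i + a) + (2 + 2 * i)
        e₂ = ℕ-Solver.solve-∀
      x₁-exponent : x₁ ≈ qpow (a + 2) ⊗ x₃
      x₁-exponent = ≈-trans (reflexive (cong qpow (e₃ a i))) (qpow-+ (a + 2) (i * (2 * i + (a + 4))))
        where
        e₃ : ∀ a i → suc i * (2 * suc i + a) ≡ a + 2 + i * (2 * i + (a + 4))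
        e₃ = ℕ-Solver.solve-∀

  T-step : z₀ ⊗ z₂ ⊗ (T a (suc i) ⊖ T (a + 2) (suc i)) ≈ qpow (a + 2) ⊗ T (a + 4) i
  T-step = ⊗-cancelʳ M M-const (begin
    z₀ ⊗ z₂ ⊗ (T₁ ⊖ T₂) ⊗ M
      ≈⟨ solve 5 (λ z₀ z₂ t₁ t₂ m → z₀ :* z₂ :* (t₁ :- t₂) :* m := z₀ :* z₂ :* (t₁ :* m :- t₂ :* m))
               ≈-refl z₀ z₂ T₁ T₂ M ⟩
    z₀ ⊗ z₂ ⊗ (T₁ ⊗ M ⊖ T₂ ⊗ M)
      ≈⟨ ⊗-congˡ (z₀ ⊗ z₂) (⊖-cong T₁-cleared T₂-cleared) ⟩
    z₀ ⊗ z₂ ⊗ (x₁ ⊗ u ⊖ x₂ ⊗ z₀)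
      ≈⟨ ⊗-congˡ (z₀ ⊗ z₂) numerators ⟩
    z₀ ⊗ z₂ ⊗ (qpow (a + 2) ⊗ x₃ ⊗ v)
      ≈⟨ solve 5 (λ z₀ z₂ c x v → z₀ :* z₂ :* (c :* x :* v) := c :* (x :* (v :* z₂ :* z₀)))
               ≈-refl z₀ z₂ (qpow (a + 2)) x₃ v ⟩
    qpow (a + 2) ⊗ (x₃ ⊗ (v ⊗ z₂ ⊗ z₀))
      ≈⟨ ⊗-congˡ (qpow (a + 2)) T₃-cleared ⟨
    qpow (a + 2) ⊗ (T₃ ⊗ M)
      ≈⟨ *-assoc (qpow (a + 2)) T₃ M ⟨
    qpow (a + 2) ⊗ T₃ ⊗ M
      ∎)
    where
    open SetoidReasoning setoid
    T₁ T₂ T₃ : FPS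
    T₁ = T a (suc i)
    T₂ = T (a + 2) (suc i)
    T₃ = T (a + 4) i

S-step : ∀ a → 1 ≤ a →
  (one ⊖ qpow a) ⊗ (one ⊖ qpow (a + 2)) ⊗ (S a ⊖ S (a + 2)) ≈ qpow (a + 2) ⊗ S (a + 4)
S-step a 1≤a = begin
  Z ⊗ (S a ⊖ S (a + 2))                      ≈⟨ ⊗-congˡ Z (sumInf-⊖ (T a) (T (a + 2))) ⟨
  Z ⊗ sumInf Δ                               ≈⟨ ⊗-congˡ Z (sumInf-head Δ Δ-summable) ⟩
  -- T a 0 does not depend on a, so Δ 0 is T a 0 ⊖ T a 0.
  Z ⊗ (Δ 0 ⊕ sumInf (Δ ∘ suc))               ≈⟨ ⊗-congˡ Z (λ n → cong (ℤ._+ sumInf (Δ ∘ suc) n)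
                                                                   (ℤ.+-inverseʳ (T a 0 n))) ⟩
  Z ⊗ (0ₛ ⊕ sumInf (Δ ∘ suc))                ≈⟨ ⊗-congˡ Z (λ n → ℤ.+-identityˡ (sumInf (Δ ∘ suc) n)) ⟩
  Z ⊗ sumInf (Δ ∘ suc)                       ≈⟨ ⊗-sumInf Z (Δ ∘ suc) (summable-suc Δ Δ-summable) ⟩
  sumInf (λ i → Z ⊗ Δ (suc i))               ≈⟨ sumInf-cong (λ i → T-step a i 1≤a) ⟩
  sumInf (λ i → qpow (a + 2) ⊗ T (a + 4) i)  ≈⟨ ⊗-sumInf (qpow (a + 2)) (T (a + 4)) (T-summable (a + 4)) ⟨
  qpow (a + 2) ⊗ S (a + 4)                   ∎
  where
  open SetoidReasoning setoid
  Z : FPS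
  Z = (one ⊖ qpow a) ⊗ (one ⊖ qpow (a + 2))
  Δ : ℕ → FPS
  Δ j = T a j ⊖ T (a + 2) j
  Δ-summable : Summable Δ
  Δ-summable = summable-⊖ (T a) (T (a + 2)) (T-summable a) (T-summable (a + 2))

R-step : ∀ a → 1 ≤ a → R a ⊖ (one ⊖ qpow a) ⊗ R (a + 2) ≈ qpow (a + 2) ⊗ R (a + 4)
R-step a 1≤a = begin
  P a ⊗ S a ⊖ z₀ ⊗ (P (a + 2) ⊗ S (a + 2))
    ≈⟨ ⊖-cong {g = z₀ ⊗ R (a + 2)} (⊗-congʳ (S a) (pochInf-suc-head a (s≤s z≤n))) ≈-refl ⟩
  z₀ ⊗ P (a + 2) ⊗ S a ⊖ z₀ ⊗ (P (a + 2) ⊗ S (a + 2))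
    ≈⟨ solve 4 (λ z p s s′ → z :* p :* s :- z :* (p :* s′) := p :* (z :* (s :- s′)))
             ≈-refl z₀ (P (a + 2)) (S a) (S (a + 2)) ⟩
  P (a + 2) ⊗ (z₀ ⊗ (S a ⊖ S (a + 2)))
    ≈⟨ ⊗-congʳ (z₀ ⊗ (S a ⊖ S (a + 2))) (pochInf-suc-head (a + 2) (s≤s z≤n)) ⟩
  z₂ ⊗ P (a + 2 + 2) ⊗ (z₀ ⊗ (S a ⊖ S (a + 2)))
    ≈⟨ reflexive (cong (λ b → z₂ ⊗ P b ⊗ (z₀ ⊗ (S a ⊖ S (a + 2)))) (ℕ.+-assoc a 2 2)) ⟩
  z₂ ⊗ P (a + 4) ⊗ (z₀ ⊗ (S a ⊖ S (a + 2)))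
    ≈⟨ solve 4 (λ z₂ p z₀ d → z₂ :* p :* (z₀ :* d) := p :* (z₀ :* z₂ :* d))
             ≈-refl z₂ (P (a + 4)) z₀ (S a ⊖ S (a + 2)) ⟩
  P (a + 4) ⊗ (z₀ ⊗ z₂ ⊗ (S a ⊖ S (a + 2)))
    ≈⟨ ⊗-congˡ (P (a + 4)) (S-step a 1≤a) ⟩
  P (a + 4) ⊗ (qpow (a + 2) ⊗ S (a + 4))
    ≈⟨ solve 3 (λ p c s → p :* (c :* s) := c :* (p :* s)) ≈-refl (P (a + 4)) (qpow (a + 2)) (S (a + 4)) ⟩
  qpow (a + 2) ⊗ R (a + 4)
    ∎
  where
  open SetoidReasoning setoid
  P : ℕ → FPS
  P b = pochInf b 2
  z₀ z₂ : FPS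
  z₀ = one ⊖ qpow a
  z₂ = one ⊖ qpow (a + 2)

R-⊕-qpow⊗R-invariant : ∀ b → 1 ≤ b →
  R b ⊕ qpow b ⊗ R (b + 2) ≈ R (b + 2) ⊕ qpow (b + 2) ⊗ R (b + 2 + 2)
R-⊕-qpow⊗R-invariant b 1≤b = begin
  R b ⊕ qpow b ⊗ R (b + 2)
    ≈⟨ solve 4 (λ o z r r′ → r :+ z :* r′ := (r :- (o :- z) :* r′) :+ o :* r′)
             ≈-refl one (qpow b) (R b) (R (b + 2)) ⟩
  (R b ⊖ (one ⊖ qpow b) ⊗ R (b + 2)) ⊕ one ⊗ R (b + 2)
    ≈⟨ ⊕-cong (R-step b 1≤b) (⊗-identityˡ (R (b + 2))) ⟩
  qpow (b + 2) ⊗ R (b + 4) ⊕ R (b + 2)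
    ≈⟨ solve 3 (λ c r r′ → c :* r′ :+ r := r :+ c :* r′) ≈-refl (qpow (b + 2)) (R (b + 2)) (R (b + 4)) ⟩
  R (b + 2) ⊕ qpow (b + 2) ⊗ R (b + 4)
    ≈⟨ reflexive (cong (λ c → R (b + 2) ⊕ qpow (b + 2) ⊗ R c) (ℕ.+-assoc b 2 2)) ⟨
  R (b + 2) ⊕ qpow (b + 2) ⊗ R (b + 2 + 2)
    ∎
  where open SetoidReasoning setoid

S-≈[]-one : ∀ a → S a ≈[ a ] one
S-≈[]-one a n n<a = trans (sumInf-≈[]-head (T a) tail≈0 n n<a) (T-head a n)
  where
  tail≈0 : ∀ j → T a (suc j) ≈[ a ] 0ₛ
  tail≈0 j = ≈[]-mono (ℕ.≤-trans (ℕ.m≤n+m a (2 * suc j)) (ℕ.m≤n*m _ (suc j)))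
                      (qpow-⊗-≈[]-0 (suc j * (2 * suc j + a)) (inv (poch 2 2 (suc j) ⊗ poch a 2 (suc j))))

R-≈[]-one : ∀ a → R a ≈[ a ] one
R-≈[]-one a n n<a = trans (⊗-cong-≈[] (pochInf-≈[]-one a 2) (S-≈[]-one a) n n<a) (⊗-identityˡ one n)

R-⊕-qpow⊗R-≈[]-one : ∀ b → R b ⊕ qpow b ⊗ R (b + 2) ≈[ b ] one
R-⊕-qpow⊗R-≈[]-one b n n<b =
  trans (cong₂ ℤ._+_ (R-≈[]-one b n n<b) (qpow-⊗-≈[]-0 b (R (b + 2)) n n<b)) (ℤ.+-identityʳ (one n))

R-functional-equation : ∀ a → 1 ≤ a → R a ≈ one ⊖ qpow a ⊗ R (a + 2)
R-functional-equation a 1≤a = begin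
  R a
    ≈⟨ solve 2 (λ r s → r := r :+ s :- s) ≈-refl (R a) (qpow a ⊗ R (a + 2)) ⟩
  G 0 ⊖ qpow a ⊗ R (a + 2)
    ≈⟨ ⊖-cong {g = qpow a ⊗ R (a + 2)} (shift-invariant-≈ G one G-invariant G≈[]one) ≈-refl ⟩
  one ⊖ qpow a ⊗ R (a + 2)
    ∎
  where
  open SetoidReasoning setoid
  G : ℕ → FPS
  G m = R (2 * m + a) ⊕ qpow (2 * m + a) ⊗ R (2 * m + a + 2)
  G-invariant : ∀ m → G m ≈ G (suc m)
  G-invariant m = ≈-trans (R-⊕-qpow⊗R-invariant (2 * m + a) (ℕ.≤-trans 1≤a (ℕ.m≤n+m a _)))
    (reflexive (cong (λ b → R b ⊕ qpow b ⊗ R (b + 2)) (index m a)))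
    where
    index : ∀ m a → 2 * m + a + 2 ≡ 2 * suc m + a
    index = ℕ-Solver.solve-∀
  G≈[]one : ∀ m → G m ≈[ m ] one
  G≈[]one m = ≈[]-mono (ℕ.≤-trans (ℕ.m≤n*m m 2) (ℕ.m≤m+n (2 * m) a)) (R-⊕-qpow⊗R-≈[]-one (2 * m + a))

-- The left-hand side

V : ℕ → ℕ → FPS
V b j = (-1ℤ ^ j) · qpow (j * j + j * b)

L : ℕ → FPS
L b = sumInf (V b)

V-summable : ∀ b → Summable (V b)
V-summable b j =
  ·-≈[]-0 (-1ℤ ^ j) (≈[]-mono (ℕ.≤-trans (j≤j*j j) (ℕ.m≤m+n (j * j) (j * b))) (qpow-≈[]-0 _))
  where
  j≤j*j : ∀ j → j ≤ j * j
  j≤j*j zero    = z≤n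
  j≤j*j (suc j) = ℕ.m≤m*n (suc j) (suc j)

V-suc : ∀ b j → V b (suc j) ≈ ⊝ (qpow (suc b) ⊗ V (b + 2) j)
V-suc b j = begin
  (-1ℤ ℤ.* s) · qpow (suc j * suc j + suc j * b)  ≈⟨ (λ n → cong (ℤ._*_ (-1ℤ ℤ.* s)) (exponent n)) ⟩
  (-1ℤ ℤ.* s) · (qpow (suc b) ⊗ qpow E)           ≈⟨ (λ n → sign s ((qpow (suc b) ⊗ qpow E) n)) ⟩
  ⊝ (s · (qpow (suc b) ⊗ qpow E))                 ≈⟨ (λ n → cong -_ (⊗-·-comm s (qpow (suc b)) (qpow E) n)) ⟨
  ⊝ (qpow (suc b) ⊗ (s · qpow E))                 ∎
  where
  open SetoidReasoning setoid
  s : ℤ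
  s = -1ℤ ^ j
  E : ℕ
  E = j * j + j * (b + 2)
  exponent : qpow (suc j * suc j + suc j * b) ≈ qpow (suc b) ⊗ qpow E
  exponent = ≈-trans (reflexive (cong qpow (split b j))) (qpow-+ (suc b) E)
    where
    split : ∀ b j → suc j * suc j + suc j * b ≡ suc b + (j * j + j * (b + 2))
    split = ℕ-Solver.solve-∀
  sign : ∀ s x → (-1ℤ ℤ.* s) ℤ.* x ≡ - (s ℤ.* x)
  sign = ℤ-Solver.solve-∀

L-functional-equation : ∀ b → L b ≈ one ⊖ qpow (suc b) ⊗ L (b + 2)
L-functional-equation b = begin
  L b
    ≈⟨ sumInf-head (V b) (V-summable b) ⟩
  V b 0 ⊕ sumInf (V b ∘ suc)
    ≈⟨ ⊕-cong (λ n → ℤ.*-identityˡ (one n)) (sumInf-cong (V-suc b)) ⟩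
  one ⊕ sumInf (λ j → ⊝ (qpow (suc b) ⊗ V (b + 2) j))
    ≈⟨ ⊕-cong {one} {one} ≈-refl (sumInf-⊝ (λ j → qpow (suc b) ⊗ V (b + 2) j)) ⟩
  one ⊕ ⊝ sumInf (λ j → qpow (suc b) ⊗ V (b + 2) j)
    ≈⟨ ⊕-cong {one} {one} ≈-refl
              (λ n → cong -_ (⊗-sumInf (qpow (suc b)) (V (b + 2)) (V-summable (b + 2)) n)) ⟨
  one ⊖ qpow (suc b) ⊗ L (b + 2)
    ∎
  where open SetoidReasoning setoid

L≈R : ∀ b → L b ≈ R (suc b)
L≈R = functional-equation-unique (_+ 2) (λ b → b) (λ _ → one) L (R ∘ suc)
  L-functional-equation (λ b → R-functional-equation (suc b) (s≤s z≤n))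

-- The identity holds for every k.
lemma2p1 : (k : ℕ) → 1 ≤ k →
    sumInf (λ j → (-1ℤ ^ j) · qpow (j * j + 2 * j * (k + 1)))
    ≈ pochInf (2 * k + 3) 2
      ⊗ sumInf (λ j → qpow (j * (2 * j + 2 * k + 3))
                       ⊗ inv (poch 2 2 j ⊗ poch (2 * k + 3) 2 j))
lemma2p1 k _ = begin
  sumInf (λ j → (-1ℤ ^ j) · qpow (j * j + 2 * j * (k + 1)))
    ≈⟨ sumInf-cong (λ j → reflexive (cong (λ e → (-1ℤ ^ j) · qpow e) (e₁ j k))) ⟩
  L (2 * k + 2)
    ≈⟨ L≈R (2 * k + 2) ⟩
  R (suc (2 * k + 2))
    ≈⟨ reflexive (cong R (e₂ k)) ⟩
  pochInf (2 * k + 3) 2 ⊗ S (2 * k + 3)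
    ≈⟨ ⊗-congˡ (pochInf (2 * k + 3) 2) (sumInf-cong (λ j →
         reflexive (cong (λ e → qpow e ⊗ inv (poch 2 2 j ⊗ poch (2 * k + 3) 2 j)) (e₃ j k)))) ⟩
  pochInf (2 * k + 3) 2 ⊗ sumInf (λ j → qpow (j * (2 * j + 2 * k + 3))
                                          ⊗ inv (poch 2 2 j ⊗ poch (2 * k + 3) 2 j))
    ∎
  where
  open SetoidReasoning setoid
  e₁ : ∀ j k → j * j + 2 * j * (k + 1) ≡ j * j + j * (2 * k + 2)
  e₁ = ℕ-Solver.solve-∀
  e₂ : ∀ k → suc (2 * k + 2) ≡ 2 * k + 3
  e₂ = ℕ-Solver.solve-∀
  e₃ : ∀ j k → j * (2 * j + (2 * k + 3)) ≡ j * (2 * j + 2 * k + 3)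
  e₃ = ℕ-Solver.solve-∀
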